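{- Let $\delta>0$ be a constant and let $G$ be a graph (with at least one edge) with edge density $\epsilon=|E(G)|/|G|$. Let $\tau$ be any threshold assignment for $G$ whose average threshold $\bar t=\sum_v\tau(v)/|G|$ satisfies $\bar{t}\geq (1+\delta)\epsilon$, and let $M$ be any $\tau$-dynamic monopoly of $G$. Then $|M|\geq \delta\epsilon$.
   Context: Graphs are finite, undirected, simple. A threshold assignment for $G$ is a function $\tau:V(G)\to\mathbb{N}\cup\{0\}$ with $\tau(v)\le \deg(v)$ for every $v$. For $M\subseteq V(G)$, the $\tau$-dynamic process starting from $M$ is $D_0=M$ and, for $i\ge0$, $D_{i+1}$ = set of vertices $v\notin D_0\cup\dots\cup D_i$ with at least $\tau(v)$ neighbours in $D_0\cup\dots\cup D_i$; $M$ is a $\tau$-dynamic monopoly if $\bigcup_i D_i=V(G)$.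
   Formalization: The constant δ ranges over the positive rationals. -}

module Defs where

open import Data.Nat using (ℕ; zero; suc; _+_; _≤_; _<_; _≤ᵇ_)
open import Data.Bool using (Bool; true; false; _∧_; _∨_; if_then_else_)
open import Data.Fin using (Fin; toℕ)
import Data.Fin as F
open import Data.Product using (∃)
open import Data.Integer using (+_)
open import Data.Rational using (ℚ; 0ℚ; _/_)
open import Relation.Binary.PropositionalEquality using (_≡_)

record Graph (n : ℕ) : Set where
  field
    adj     : Fin n → Fin n → Bool
    symm    : ∀ u v → adj u v ≡ adj v u
    irrefl  : ∀ v → adj v v ≡ false
open Graph public

count : {n : ℕ} → (Fin n → Bool) → ℕ
count {zero}  P = 0
count {suc n} P = (if P F.zero then 1 else 0) + count (λ i → P (F.suc i))

sumFin : {n : ℕ} → (Fin n → ℕ) → ℕ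
sumFin {zero}  f = 0
sumFin {suc n} f = f F.zero + sumFin (λ i → f (F.suc i))

deg : {n : ℕ} → Graph n → Fin n → ℕ
deg G v = count (adj G v)

numEdges : {n : ℕ} → Graph n → ℕ
numEdges G = sumFin (λ v → count (λ u → (suc (toℕ u) ≤ᵇ toℕ v) ∧ adj G u v))

IsThreshold : {n : ℕ} → Graph n → (Fin n → ℕ) → Set
IsThreshold G τ = ∀ v → τ v ≤ deg G v

-- active G τ M k v = true  iff  v ∈ D_0 ∪ ... ∪ D_k  for the τ-dynamic process from M
active : {n : ℕ} → Graph n → (Fin n → ℕ) → (Fin n → Bool) → ℕ → Fin n → Bool
active G τ M zero    v = M v
active G τ M (suc k) v =
  active G τ M k v ∨ (τ v ≤ᵇ count (λ u → adj G v u ∧ active G τ M k u))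

IsDynamicMonopoly : {n : ℕ} → Graph n → (Fin n → ℕ) → (Fin n → Bool) → Set
IsDynamicMonopoly G τ M = ∃ λ k → ∀ v → active G τ M k v ≡ true

-- a / n as a rational (n = |G|; the value for n = 0 is irrelevant, set to 0)
frac : ℕ → ℕ → ℚ
frac a zero    = 0ℚ
frac a (suc m) = (+ a) / suc m

-- Order the vertices by the round in which the dynamic process activates them.
-- A vertex outside M is activated by at least τ(v) neighbours activated strictly
-- earlier, and each edge points from an earlier to a strictly later vertex at most
-- once; a vertex of M has τ(v) ≤ deg(v) ≤ |G|. Hence Σ τ ≤ |M|·|G| + |E(G)|, that
-- is t̄ ≤ |M| + ε, and with t̄ ≥ (1 + δ)ε this leaves δε ≤ |M|.
module Submission where

open import Defs

module Counting where
  open import Data.Bool using (Bool; true; false; _∧_; if_then_else_)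
  open import Data.Fin using (Fin; toℕ)
  import Data.Fin as F
  open import Data.Nat using (ℕ; zero; suc; _+_; _*_; _≤_; _<ᵇ_; z≤n; s≤s)
  open import Data.Nat.Properties
    using (≤-refl; +-mono-≤; +-assoc; m≤n⇒m≤1+n; +-commutativeSemigroup; module ≤-Reasoning)
  open import Algebra.Properties.CommutativeSemigroup +-commutativeSemigroup using (interchange)
  open import Relation.Binary.PropositionalEquality using (_≡_; refl; sym; trans; cong; cong₂)

  private variable n : ℕ

  [_] : Bool → ℕ
  [ b ] = if b then 1 else 0

  [m<ᵇn]+[n<ᵇm]≤1 : ∀ m n → [ m <ᵇ n ] + [ n <ᵇ m ] ≤ 1
  [m<ᵇn]+[n<ᵇm]≤1 zero    zero    = z≤n
  [m<ᵇn]+[n<ᵇm]≤1 zero    (suc n) = ≤-refl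
  [m<ᵇn]+[n<ᵇm]≤1 (suc m) zero    = ≤-refl
  [m<ᵇn]+[n<ᵇm]≤1 (suc m) (suc n) = [m<ᵇn]+[n<ᵇm]≤1 m n

  count≡sumFin : (P : Fin n → Bool) → count P ≡ sumFin (λ i → [ P i ])
  count≡sumFin {zero}  P = refl
  count≡sumFin {suc n} P = cong ([ P F.zero ] +_) (count≡sumFin (λ i → P (F.suc i)))

  count-false : count {n} (λ _ → false) ≡ 0
  count-false {zero}  = refl
  count-false {suc n} = count-false {n}

  count≤n : (P : Fin n → Bool) → count P ≤ n
  count≤n {zero}  P = z≤n
  count≤n {suc n} P with P F.zero
  ... | true  = s≤s (count≤n (λ i → P (F.suc i)))
  ... | false = m≤n⇒m≤1+n (count≤n (λ i → P (F.suc i)))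

  count-mono : (P Q : Fin n → Bool) → (∀ i → P i ≡ true → Q i ≡ true) → count P ≤ count Q
  count-mono {zero}  P Q P⇒Q = z≤n
  count-mono {suc n} P Q P⇒Q with P F.zero in P0
  ... | true  rewrite P⇒Q F.zero P0 = s≤s (count-mono (λ i → P (F.suc i)) (λ i → Q (F.suc i)) (λ i → P⇒Q (F.suc i)))
  ... | false = +-mono-≤ z≤n (count-mono (λ i → P (F.suc i)) (λ i → Q (F.suc i)) (λ i → P⇒Q (F.suc i)))

  sumFin-mono : (f g : Fin n → ℕ) → (∀ i → f i ≤ g i) → sumFin f ≤ sumFin g
  sumFin-mono {zero}  f g f≤g = z≤n
  sumFin-mono {suc n} f g f≤g =
    +-mono-≤ (f≤g F.zero) (sumFin-mono (λ i → f (F.suc i)) (λ i → g (F.suc i)) (λ i → f≤g (F.suc i)))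

  sumFin-+ : (f g : Fin n → ℕ) → sumFin (λ i → f i + g i) ≡ sumFin f + sumFin g
  sumFin-+ {zero}  f g = refl
  sumFin-+ {suc n} f g = trans
    (cong (f F.zero + g F.zero +_) (sumFin-+ (λ i → f (F.suc i)) (λ i → g (F.suc i))))
    (interchange (f F.zero) (g F.zero) _ _)

  sumFin-if : (P : Fin n → Bool) (c : ℕ) → sumFin (λ i → if P i then c else 0) ≡ count P * c
  sumFin-if {zero}  P c = refl
  sumFin-if {suc n} P c with P F.zero
  ... | true  = cong (c +_) (sumFin-if (λ i → P (F.suc i)) c)
  ... | false = sumFin-if (λ i → P (F.suc i)) c

  -- numEdges G unfolds to pairCount (lower (adj G)).
  lower : (Fin n → Fin n → Bool) → Fin n → Fin n → Bool
  lower S v u = (toℕ u <ᵇ toℕ v) ∧ S u v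

  pairCount : (Fin n → Fin n → Bool) → ℕ
  pairCount R = sumFin (λ v → count (R v))

  [b]+[b]≤[c]⇒[b]≡0 : ∀ b c → [ b ] + [ b ] ≤ [ c ] → [ b ] ≡ 0
  [b]+[b]≤[c]⇒[b]≡0 false c    _          = refl
  [b]+[b]≤[c]⇒[b]≡0 true  true (s≤s ())
  [b]+[b]≤[c]⇒[b]≡0 true  false ()

  -- Vertex zero's row and column of R are jointly dominated by its row of S.
  pairCount-≤-lower : (R S : Fin n → Fin n → Bool) →
                      (∀ u v → [ R u v ] + [ R v u ] ≤ [ S u v ]) →
                      pairCount R ≤ pairCount (lower S)
  pairCount-≤-lower {zero}  R S R≤S = z≤n
  pairCount-≤-lower {suc n} R S R≤S = begin
      ([ R 0F 0F ] + count row) + sumFin (λ v → col v + count (R′ v))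
    ≡⟨ cong₂ _+_ (cong₂ _+_ ([b]+[b]≤[c]⇒[b]≡0 _ _ (R≤S 0F 0F)) (count≡sumFin row))
                 (sumFin-+ col (λ v → count (R′ v))) ⟩
      sumFin (λ u → [ row u ]) + (sumFin col + pairCount R′)
    ≡⟨ sym (+-assoc (sumFin (λ u → [ row u ])) (sumFin col) (pairCount R′)) ⟩
      (sumFin (λ u → [ row u ]) + sumFin col) + pairCount R′
    ≡⟨ cong (_+ pairCount R′) (sym (sumFin-+ (λ u → [ row u ]) col)) ⟩
      sumFin (λ u → [ row u ] + col u) + pairCount R′
    ≤⟨ +-mono-≤ (sumFin-mono _ _ (λ u → R≤S 0F (F.suc u)))
                (pairCount-≤-lower R′ S′ (λ u v → R≤S (F.suc u) (F.suc v))) ⟩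
      sumFin (λ v → [ S 0F (F.suc v) ]) + pairCount (lower S′)
    ≡⟨ sym (trans (cong (_+ sumFin (λ v → count (lower S (F.suc v)))) (count-false {suc n}))
                  (sumFin-+ (λ v → [ S 0F (F.suc v) ]) (λ v → count (lower S′ v)))) ⟩
      count (lower S 0F) + sumFin (λ v → count (lower S (F.suc v))) ∎
    where
    open ≤-Reasoning
    0F : Fin (suc n)
    0F = F.zero
    row : Fin n → Bool
    row u = R 0F (F.suc u)
    col : Fin n → ℕ
    col v = [ R (F.suc v) 0F ]
    R′ S′ : Fin n → Fin n → Bool
    R′ v u = R (F.suc v) (F.suc u)
    S′ v u = S (F.suc v) (F.suc u)

  firstTrue : (ℕ → Bool) → ℕ → ℕ
  firstTrue P zero    = 0
  firstTrue P (suc k) = if P 0 then 0 else suc (firstTrue (λ i → P (suc i)) k)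

  firstTrue-true : (P : ℕ → Bool) (k : ℕ) → P k ≡ true → P (firstTrue P k) ≡ true
  firstTrue-true P zero    Pk = Pk
  firstTrue-true P (suc k) Pk with P 0 in P0
  ... | true  = P0
  ... | false = firstTrue-true (λ i → P (suc i)) k Pk

  firstTrue-least : (P : ℕ → Bool) (k j : ℕ) → P j ≡ true → firstTrue P k ≤ j
  firstTrue-least P zero    j       Pj = z≤n
  firstTrue-least P (suc k) j       Pj with P 0 in P0
  firstTrue-least P (suc k) j       Pj | true  = z≤n
  firstTrue-least P (suc k) zero    Pj | false with () ← trans (sym Pj) P0
  firstTrue-least P (suc k) (suc j) Pj | false = s≤s (firstTrue-least (λ i → P (suc i)) k j Pj)

module DynamicProcess where
  open import Data.Bool using (Bool; true; false; _∧_; _∨_; if_then_else_)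
  open import Data.Bool.Properties using (T-≡)
  open import Data.Fin using (Fin)
  open import Data.Nat using (ℕ; zero; suc; _+_; _*_; _≤_; _<ᵇ_; _≤ᵇ_; z≤n; s≤s)
  open import Data.Nat.Properties
    using (≤-reflexive; ≤-trans; +-mono-≤; m≤m+n; <⇒<ᵇ; ≤ᵇ⇒≤; 1+n≰n; module ≤-Reasoning)
  open import Data.Product using (_,_)
  open import Function.Bundles using (Equivalence)
  open import Relation.Binary.PropositionalEquality using (_≡_; refl; sym; trans; subst)
  open Counting

  module _ {n : ℕ} (G : Graph n) where

    earlierNeighbour : (Fin n → ℕ) → Fin n → Fin n → Bool
    earlierNeighbour t v u = adj G v u ∧ (t u <ᵇ t v)

    earlierNeighbours≤numEdges : (t : Fin n → ℕ) → pairCount (earlierNeighbour t) ≤ numEdges G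
    earlierNeighbours≤numEdges t = pairCount-≤-lower (earlierNeighbour t) (adj G) oriented
      where
      oriented : ∀ u v → [ earlierNeighbour t u v ] + [ earlierNeighbour t v u ] ≤ [ adj G u v ]
      oriented u v rewrite symm G v u with adj G u v
      ... | true  = [m<ᵇn]+[n<ᵇm]≤1 (t v) (t u)
      ... | false = z≤n

    module _ (τ : Fin n → ℕ) (M : Fin n → Bool) where

      newlyActive⇒threshold≤activeNeighbours :
        ∀ j v → active G τ M j v ≡ false → active G τ M (suc j) v ≡ true →
        τ v ≤ count (λ u → adj G v u ∧ active G τ M j u)
      newlyActive⇒threshold≤activeNeighbours j v inactive nowActive =
        ≤ᵇ⇒≤ (τ v) c (Equivalence.from T-≡ (subst (λ b → (b ∨ (τ v ≤ᵇ c)) ≡ true) inactive nowActive))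
        where
        c : ℕ
        c = count (λ u → adj G v u ∧ active G τ M j u)

      activationTime : ℕ → Fin n → ℕ
      activationTime K v = firstTrue (λ k → active G τ M k v) K

      threshold≤earlierNeighbours : ∀ K v → active G τ M K v ≡ true → M v ≡ false →
                                    τ v ≤ count (earlierNeighbour (activationTime K) v)
      threshold≤earlierNeighbours K v activeK v∉M = bound (t v) refl
        where
        t : Fin n → ℕ
        t = activationTime K

        timeBy : ∀ u j → active G τ M j u ≡ true → t u ≤ j
        timeBy u = firstTrue-least (λ k → active G τ M k u) K

        activeAt : ∀ k → k ≡ t v → active G τ M k v ≡ true
        activeAt k refl = firstTrue-true (λ k → active G τ M k v) K activeK

        inactiveBefore : ∀ j → suc j ≡ t v → active G τ M j v ≡ false
        inactiveBefore j 1+j≡t with active G τ M j v in activeJ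
        ... | true  with () ← 1+n≰n (subst (_≤ j) (sym 1+j≡t) (timeBy v j activeJ))
        ... | false = refl

        activatedEarlier : ∀ j u → (adj G v u ∧ active G τ M j u) ≡ true →
                           (adj G v u ∧ (t u <ᵇ suc j)) ≡ true
        activatedEarlier j u h with adj G v u
        ... | true  = Equivalence.to T-≡ (<⇒<ᵇ (s≤s (timeBy u j h)))
        ... | false = h

        bound : ∀ k → k ≡ t v → τ v ≤ count (λ u → adj G v u ∧ (t u <ᵇ k))
        bound zero    0≡t   with () ← trans (sym v∉M) (activeAt 0 0≡t)
        bound (suc j) 1+j≡t = ≤-trans
          (newlyActive⇒threshold≤activeNeighbours j v (inactiveBefore j 1+j≡t) (activeAt (suc j) 1+j≡t))
          (count-mono _ _ (activatedEarlier j))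

      thresholdSum≤ : IsThreshold G τ → IsDynamicMonopoly G τ M → sumFin τ ≤ count M * n + numEdges G
      thresholdSum≤ τ≤deg (K , allActive) = begin
          sumFin τ
        ≤⟨ sumFin-mono τ _ perVertex ⟩
          sumFin (λ v → seedBound v + earlier v)
        ≡⟨ sumFin-+ seedBound earlier ⟩
          sumFin seedBound + pairCount (earlierNeighbour (activationTime K))
        ≤⟨ +-mono-≤ (≤-reflexive (sumFin-if M n)) (earlierNeighbours≤numEdges (activationTime K)) ⟩
          count M * n + numEdges G ∎
        where
        open ≤-Reasoning
        seedBound earlier : Fin n → ℕ
        seedBound v = if M v then n else 0
        earlier v = count (earlierNeighbour (activationTime K) v)

        perVertex : ∀ v → τ v ≤ seedBound v + earlier v
        perVertex v with M v in v∈M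
        ... | true  = ≤-trans (τ≤deg v) (≤-trans (count≤n (adj G v)) (m≤m+n n (earlier v)))
        ... | false = threshold≤earlierNeighbours K v (allActive v) v∈M

open import Data.Nat using (ℕ; _<_; zero; suc)
import Data.Nat as ℕ
import Data.Nat.Properties as ℕ
open import Data.Bool using (Bool)
open import Data.Fin using (Fin)
open import Data.Integer using (+_)
import Data.Integer as ℤ
import Data.Integer.Properties as ℤ
open import Data.Rational using (ℚ; 1ℚ; 0ℚ; _+_; _*_; _/_; -_; toℚᵘ) renaming (_≤_ to _≤ℚ_; _<_ to _<ℚ_)
open import Data.Rational.Properties
open import Data.Rational.Unnormalised as ℚᵘ using (mkℚᵘ; *≤*)
import Data.Rational.Unnormalised.Properties as ℚᵘ
open import Relation.Binary.PropositionalEquality using (_≡_; sym; trans; cong)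

frac-≤-frac+ : ∀ n′ a e m → a ℕ.≤ m ℕ.* suc n′ ℕ.+ e → frac a (suc n′) ≤ℚ frac e (suc n′) + (+ m) / 1
frac-≤-frac+ n′ a e m a≤ = toℚᵘ-cancel-≤ (begin
    toℚᵘ (frac a N)                            ≃⟨ toℚᵘ-fromℚᵘ (mkℚᵘ (+ a) n′) ⟩
    mkℚᵘ (+ a) n′                              ≤⟨ *≤* crossMultiplied ⟩
    mkℚᵘ (+ e) n′ ℚᵘ.+ mkℚᵘ (+ m) 0            ≃⟨ ℚᵘ.+-cong (toℚᵘ-fromℚᵘ (mkℚᵘ (+ e) n′)) (toℚᵘ-fromℚᵘ (mkℚᵘ (+ m) 0)) ⟨
    toℚᵘ (frac e N) ℚᵘ.+ toℚᵘ ((+ m) / 1)      ≃⟨ toℚᵘ-homo-+ (frac e N) ((+ m) / 1) ⟨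
    toℚᵘ (frac e N + (+ m) / 1)                ∎)
  where
  open ℚᵘ.≤-Reasoning
  N : ℕ
  N = suc n′
  crossMultiplied : (+ a) ℤ.* (+ (N ℕ.* 1)) ℤ.≤ ((+ e) ℤ.* (+ 1) ℤ.+ (+ m) ℤ.* (+ N)) ℤ.* (+ N)
  crossMultiplied
    rewrite sym (ℤ.pos-* a (N ℕ.* 1)) | sym (ℤ.pos-* e 1) | sym (ℤ.pos-* m N)
          | sym (ℤ.pos-+ (e ℕ.* 1) (m ℕ.* N)) | sym (ℤ.pos-* (e ℕ.* 1 ℕ.+ m ℕ.* N) N)
          | ℕ.*-identityʳ N | ℕ.*-identityʳ e
    = ℤ.+≤+ (ℕ.*-monoˡ-≤ N (ℕ.≤-trans a≤ (ℕ.≤-reflexive (ℕ.+-comm (m ℕ.* N) e))))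

-r+[r+p]≡p : ∀ r p → - r + (r + p) ≡ p
-r+[r+p]≡p r p = trans (sym (+-assoc (- r) r p)) (trans (cong (_+ p) (+-inverseˡ r)) (+-identityˡ p))

+-cancelˡ-≤ : ∀ r {p q} → r + p ≤ℚ r + q → p ≤ℚ q
+-cancelˡ-≤ r {p} {q} r+p≤r+q = begin
  p               ≡⟨ -r+[r+p]≡p r p ⟨
  - r + (r + p)   ≤⟨ +-monoʳ-≤ (- r) r+p≤r+q ⟩
  - r + (r + q)   ≡⟨ -r+[r+p]≡p r q ⟩
  q               ∎
  where open ≤-Reasoning

corollary1 : (δ : ℚ) → 0ℚ <ℚ δ →
    (n : ℕ) (G : Graph n) → 0 < numEdges G →
    (τ : Fin n → ℕ) → IsThreshold G τ →
    (1ℚ + δ) * frac (numEdges G) n ≤ℚ frac (sumFin τ) n →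
    (M : Fin n → Bool) → IsDynamicMonopoly G τ M →
    δ * frac (numEdges G) n ≤ℚ (+ count M) / 1
corollary1 δ _ zero    G ()
corollary1 δ _ (suc n′) G _ τ τ≤deg t̄≥[1+δ]ε M monopoly = +-cancelˡ-≤ ε (begin
    ε + δ * ε                  ≡⟨ trans (*-distribʳ-+ ε 1ℚ δ) (cong (_+ δ * ε) (*-identityˡ ε)) ⟨
    (1ℚ + δ) * ε               ≤⟨ t̄≥[1+δ]ε ⟩
    frac (sumFin τ) (suc n′)   ≤⟨ frac-≤-frac+ n′ (sumFin τ) (numEdges G) (count M) thresholdSum≤ ⟩
    ε + (+ count M) / 1        ∎)
  where
  open ≤-Reasoning
  ε : ℚ
  ε = frac (numEdges G) (suc n′)
  thresholdSum≤ : sumFin τ ℕ.≤ count M ℕ.* suc n′ ℕ.+ numEdges G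
  thresholdSum≤ = DynamicProcess.thresholdSum≤ G τ M τ≤deg monopoly
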